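{- Let $G$ be a graph on $n$ vertices (multiple edges allowed) with a shuffle-preserved $m$-coloring using colors from $\{1,\dots,m\}$, and let $t$ be an integer with $1\le t\le m$. For each $i$, let $d_i$ be the number of vertices of $G$ whose incident edges carry exactly $i$ different colors. If $p$ is a positive integer with $$p\le\left\lceil\frac{\sum_{i=t}^{m} d_i\binom{i}{t}}{\binom{m}{t}}\right\rceil,$$ then $G$ contains a $t$-superimposed copy of $K_p$.
   Context: An $m$-coloring assigns to each edge one of at most $m$ colors. For a color $c$, let $V_c$ be the set of vertices incident to at least one edge of color $c$; the coloring is shuffle-preserved if for every color $c$ the subgraph formed by the edges of color $c$ is complete on $V_c$, i.e. any two distinct vertices of $V_c$ are joined by an edge of color $c$. A $t$-superimposed copy of $K_p$ is a set $P$ of $p$ vertices together with $t$ distinct colors $c_1,\dots,c_t$ such that every two distinct vertices of $P$ are joined by an edge of color $c_j$ for each $j=1,\dots,t$ (equivalently, $P\subseteq V_{c_1}\cap\cdots\cap V_{c_t}$). -}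

module Defs where

open import Data.Nat using (ℕ; zero; suc; _+_; _*_; _∸_; _≟_)
open import Data.Nat.DivMod using (_/_)
open import Data.Nat.Combinatorics using (_C_)
open import Data.Fin using (Fin)
open import Data.Fin.Properties using () renaming (_≟_ to _≟ᶠ_)
open import Data.List using (List; length; filter; allFin; upTo; map)
open import Data.Nat.ListAction using (sum)
open import Data.List.Relation.Unary.Any using (Any; any?)
open import Data.Product using (_×_; Σ-syntax)
open import Data.Sum using (_⊎_)
open import Relation.Nullary using (¬_)
open import Relation.Nullary.Decidable using (_×-dec_; _⊎-dec_)
open import Relation.Binary.PropositionalEquality using (_≡_; _≢_)
open import Function.Definitions using (Injective)

-- An edge of a multigraph on vertex set Fin n, coloured with a colour from
-- Fin m (colours 1..m are represented by Fin m).
record Edge (n m : ℕ) : Set where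
  constructor edge
  field
    src    : Fin n
    tgt    : Fin n
    colour : Fin m
open Edge public

-- A multigraph (multiple edges allowed) on n vertices with an m-colouring:
-- a list of coloured edges; repetitions in the list are parallel edges.
ColouredMultigraph : ℕ → ℕ → Set
ColouredMultigraph n m = List (Edge n m)

Loopless : ∀ {n m} → ColouredMultigraph n m → Set
Loopless {n} {m} G = ∀ (e : Edge n m) → Any (e ≡_) G → src e ≢ tgt e

InV : ∀ {n m} → ColouredMultigraph n m → Fin m → Fin n → Set
InV G c v = Any (λ e → colour e ≡ c × (src e ≡ v ⊎ tgt e ≡ v)) G

InV? : ∀ {n m} (G : ColouredMultigraph n m) (c : Fin m) (v : Fin n) →
       Relation.Nullary.Dec (InV G c v)
InV? G c v = any? (λ e → (colour e ≟ᶠ c) ×-dec ((src e ≟ᶠ v) ⊎-dec (tgt e ≟ᶠ v))) G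

Joined : ∀ {n m} → ColouredMultigraph n m → Fin m → Fin n → Fin n → Set
Joined G c u v =
  Any (λ e → colour e ≡ c × ((src e ≡ u × tgt e ≡ v) ⊎ (src e ≡ v × tgt e ≡ u))) G

ShufflePreserved : ∀ {n m} → ColouredMultigraph n m → Set
ShufflePreserved {n} {m} G =
  ∀ (c : Fin m) (u v : Fin n) → u ≢ v → InV G c u → InV G c v → Joined G c u v

colourDegree : ∀ {n m} → ColouredMultigraph n m → Fin n → ℕ
colourDegree {n} {m} G v = length (filter (λ c → InV? G c v) (allFin m))

d : ∀ {n m} → ColouredMultigraph n m → ℕ → ℕ
d {n} G i = length (filter (λ v → colourDegree G v ≟ i) (allFin n))

weightedSum : ∀ {n m} → ColouredMultigraph n m → ℕ → ℕ
weightedSum {n} {m} G t =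
  sum (map (λ i → d G i * (i C t)) (map (t +_) (upTo (suc (m ∸ t)))))

-- ceiling division ⌈ a / b ⌉ (for b > 0; value 0 for b = 0, never used)
ceilDiv : ℕ → ℕ → ℕ
ceilDiv a zero = 0
ceilDiv a (suc k) = (a + k) / suc k

SuperimposedCopy : ∀ {n m} → ColouredMultigraph n m → ℕ → ℕ → Set
SuperimposedCopy {n} {m} G t p =
  Σ[ P ∈ (Fin p → Fin n) ] Σ[ cs ∈ (Fin t → Fin m) ]
    (Injective _≡_ _≡_ P × Injective _≡_ _≡_ cs ×
     (∀ (j : Fin t) (a b : Fin p) → a ≢ b → Joined G (cs j) (P a) (P b)))

-- Double count the pairs (T, v) of a t-set T of colours and a vertex v at which every colour
-- of T occurs. Writing V_T for the vertices paired with T, the C(m,t) numbers |V_T| add up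
-- to Σ_v C(colourDegree v, t), which is at least Σ_{i ≥ t} d_i C(i,t). Hence some |V_T|
-- reaches the ceiling in the bound, and by shuffle-preservation any p vertices of V_T are
-- pairwise joined in every colour of T.
module Submission where

open import Defs
open import Data.Nat using (ℕ; _≤_)
open import Data.Nat.Combinatorics using (_C_)
open import Data.Nat.Properties

open import Algebra.Properties.CommutativeSemigroup +-commutativeSemigroup using (interchange)
open import Data.Bool using (true; false; if_then_else_)
open import Data.Fin using (Fin; zero; suc)
import Data.Fin.Properties as Fin
open import Data.Fin.Subset using (Subset; inside; outside; _∈_; ∣_∣) renaming (⊥ to ∅; ⊤ to full)
open import Data.Fin.Subset.Properties using (_⊆?_; ⊥⊆; ⊆⊤; ∣⊥∣≡0; ∣⊤∣≡n; in⊆in; out⊆; drop-∷-⊆)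
open import Data.List using (List; []; _∷_; _++_; map; length; filter; allFin)
import Data.List as List
open import Data.List.Membership.Propositional using () renaming (_∈_ to _∈ₗ_)
open import Data.List.Properties using (map-cong; length-++; filter-++; filter-≐; filter-all; filter-none; filter-accept)
open import Data.List.Relation.Unary.All as All using (All; []; _∷_)
open import Data.List.Relation.Unary.All.Properties using (++⁺; map⁺)
open import Data.List.Relation.Unary.Any using (here; there)
open import Data.List.Relation.Unary.Unique.Propositional using (Unique; []; _∷_)
import Data.List.Relation.Unary.Unique.Propositional.Properties as Unique
open import Data.Nat using (zero; suc; _+_; _*_; _∸_; _<_; z≤n; s≤s)
open import Data.Nat.Combinatorics using (nCk+nC[k+1]≡[n+1]C[k+1])
open import Data.Nat.DivMod using (m<n*o⇒m/o<n)
open import Data.Nat.ListAction using (sum)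
open import Data.Product using (Σ-syntax; ∃-syntax; _×_; _,_)
open import Data.Vec using (tabulate; []; _∷_; here; there)
open import Data.Vec.Functional using () renaming (_∷_ to _∷ᶠ_)
open import Data.Vec.Properties using ([]=⇒lookup; lookup∘tabulate)
open import Function using (_∘_; id; case_of_)
open import Function.Definitions using (Injective)
open import Level using (Level)
open import Relation.Binary using (Decidable)
open import Relation.Binary.PropositionalEquality
open import Relation.Nullary using (Dec; yes; no; does; ¬_)
open import Relation.Nullary.Decidable using (dec-true; dec-false)
open import Relation.Unary using (Pred) renaming (Decidable to Decidable₁)

private
  variable
    a ℓ : Level
    A B : Set a

indicator : Dec A → ℕ
indicator a? = if does a? then 1 else 0

indicator-yes : (a? : Dec A) → A → indicator a? ≡ 1
indicator-yes a? a = cong (λ b → if b then 1 else 0) (dec-true a? a)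

indicator-no : (a? : Dec A) → ¬ A → indicator a? ≡ 0
indicator-no a? ¬a = cong (λ b → if b then 1 else 0) (dec-false a? ¬a)

sum-map-+ : ∀ (f g : A → ℕ) xs →
            sum (map (λ x → f x + g x) xs) ≡ sum (map f xs) + sum (map g xs)
sum-map-+ f g []       = refl
sum-map-+ f g (x ∷ xs) = trans (cong (f x + g x +_) (sum-map-+ f g xs)) (interchange (f x) (g x) _ _)

sum-map-*ʳ : ∀ (f : A → ℕ) c xs → sum (map f xs) * c ≡ sum (map (λ x → f x * c) xs)
sum-map-*ʳ f c []       = refl
sum-map-*ʳ f c (x ∷ xs) = trans (*-distribʳ-+ c (f x) _) (cong (f x * c +_) (sum-map-*ʳ f c xs))

sum-map-mono-≤ : ∀ {f g : A → ℕ} → (∀ x → f x ≤ g x) → ∀ xs → sum (map f xs) ≤ sum (map g xs)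
sum-map-mono-≤ f≤g []       = z≤n
sum-map-mono-≤ f≤g (x ∷ xs) = +-mono-≤ (f≤g x) (sum-map-mono-≤ f≤g xs)

sum-map-comm : ∀ (h : A → B → ℕ) xs ys →
               sum (map (λ x → sum (map (h x) ys)) xs) ≡ sum (map (λ y → sum (map (λ x → h x y) xs)) ys)
sum-map-comm h []       ys = sym (sum-map-zero ys)
  where
  sum-map-zero : ∀ (ys : List B) → sum (map (λ _ → 0) ys) ≡ 0
  sum-map-zero []       = refl
  sum-map-zero (_ ∷ ys) = sum-map-zero ys
sum-map-comm h (x ∷ xs) ys = trans (cong (sum (map (h x) ys) +_) (sum-map-comm h xs ys))
                                   (sym (sum-map-+ (h x) _ ys))

length-filter≡sum-indicator : ∀ {P : Pred A ℓ} (P? : Decidable₁ P) xs →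
                              length (filter P? xs) ≡ sum (map (indicator ∘ P?) xs)
length-filter≡sum-indicator P? []       = refl
length-filter≡sum-indicator P? (x ∷ xs) with does (P? x)
... | true  = cong suc (length-filter≡sum-indicator P? xs)
... | false = length-filter≡sum-indicator P? xs

length-filter-map : ∀ {P : Pred B ℓ} (P? : Decidable₁ P) (f : A → B) xs →
                    length (filter P? (map f xs)) ≡ length (filter (P? ∘ f) xs)
length-filter-map P? f []       = refl
length-filter-map P? f (x ∷ xs) with does (P? (f x))
... | true  = cong suc (length-filter-map P? f xs)
... | false = length-filter-map P? f xs

sum-length-filter-comm : ∀ {R : A → B → Set ℓ} (R? : Decidable R) xs ys →
  sum (map (λ x → length (filter (R? x) ys)) xs) ≡ sum (map (λ y → length (filter (λ x → R? x y) xs)) ys)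
sum-length-filter-comm R? xs ys = begin
  sum (map (λ x → length (filter (R? x) ys)) xs)
    ≡⟨ cong sum (map-cong (λ x → length-filter≡sum-indicator (R? x) ys) xs) ⟩
  sum (map (λ x → sum (map (λ y → indicator (R? x y)) ys)) xs)
    ≡⟨ sum-map-comm (λ x y → indicator (R? x y)) xs ys ⟩
  sum (map (λ y → sum (map (λ x → indicator (R? x y)) xs)) ys)
    ≡⟨ cong sum (map-cong (λ y → length-filter≡sum-indicator (λ x → R? x y) xs) ys) ⟨
  sum (map (λ y → length (filter (λ x → R? x y) xs)) ys) ∎
  where open ≡-Reasoning

indicator-sum≡0 : ∀ (w : ℕ → ℕ) {k is} → All (k ≢_) is → sum (map (λ i → indicator (k ≟ i) * w i) is) ≡ 0
indicator-sum≡0 w []                         = refl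
indicator-sum≡0 w {k} {i ∷ is} (k≢i ∷ k∉is) =
  cong₂ _+_ (cong (_* w i) (indicator-no (k ≟ i) k≢i)) (indicator-sum≡0 w k∉is)

indicator-sum≤ : ∀ (w : ℕ → ℕ) k {is} → Unique is → sum (map (λ i → indicator (k ≟ i) * w i) is) ≤ w k
indicator-sum≤ w k []                         = z≤n
indicator-sum≤ w k {i ∷ is} (i∉is ∷ uniq) with k ≟ i
... | yes refl = ≤-reflexive (begin
  indicator (k ≟ k) * w k + sum (map (λ j → indicator (k ≟ j) * w j) is)
    ≡⟨ cong₂ _+_ (cong (_* w k) (indicator-yes (k ≟ k) refl)) (indicator-sum≡0 w i∉is) ⟩
  1 * w k + 0
    ≡⟨ trans (+-identityʳ _) (*-identityˡ (w k)) ⟩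
  w k ∎)
  where open ≡-Reasoning
... | no  k≢i  =
  ≤-trans (≤-reflexive (cong (λ c → c * w i + _) (indicator-no (k ≟ i) k≢i))) (indicator-sum≤ w k uniq)

sum-fibres≤ : ∀ (f : A → ℕ) (w : ℕ → ℕ) xs {is} → Unique is →
              sum (map (λ i → length (filter (λ x → f x ≟ i) xs) * w i) is) ≤ sum (map (w ∘ f) xs)
sum-fibres≤ f w xs {is} uniq = begin
  sum (map (λ i → length (filter (λ x → f x ≟ i) xs) * w i) is)
    ≡⟨ cong sum (map-cong (λ i → cong (_* w i) (length-filter≡sum-indicator (λ x → f x ≟ i) xs)) is) ⟩
  sum (map (λ i → sum (map (λ x → indicator (f x ≟ i)) xs) * w i) is)
    ≡⟨ cong sum (map-cong (λ i → sum-map-*ʳ (λ x → indicator (f x ≟ i)) (w i) xs) is) ⟩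
  sum (map (λ i → sum (map (λ x → indicator (f x ≟ i) * w i) xs)) is)
    ≡⟨ sum-map-comm (λ i x → indicator (f x ≟ i) * w i) is xs ⟩
  sum (map (λ x → sum (map (λ i → indicator (f x ≟ i) * w i) is)) xs)
    ≤⟨ sum-map-mono-≤ (λ x → indicator-sum≤ w (f x) uniq) xs ⟩
  sum (map (w ∘ f) xs) ∎
  where open ≤-Reasoning

subsets : (m t : ℕ) → List (Subset m)
subsets m       zero    = ∅ ∷ []
subsets zero    (suc t) = []
subsets (suc m) (suc t) = map (inside ∷_) (subsets m t) ++ map (outside ∷_) (subsets m (suc t))

subsets-size : ∀ m t → All (λ T → ∣ T ∣ ≡ t) (subsets m t)
subsets-size m       zero    = ∣⊥∣≡0 m ∷ []
subsets-size zero    (suc t) = []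
subsets-size (suc m) (suc t) =
  ++⁺ (map⁺ (All.map (cong suc) (subsets-size m t))) (map⁺ (subsets-size m (suc t)))

length-filter-subsets-suc : ∀ m t {P : Pred (Subset (suc m)) ℓ} (P? : Decidable₁ P) →
  length (filter P? (subsets (suc m) (suc t))) ≡
  length (filter (P? ∘ (inside ∷_)) (subsets m t)) + length (filter (P? ∘ (outside ∷_)) (subsets m (suc t)))
length-filter-subsets-suc m t P? = begin
  length (filter P? (map (inside ∷_) (subsets m t) ++ map (outside ∷_) (subsets m (suc t))))
    ≡⟨ cong length (filter-++ P? (map (inside ∷_) (subsets m t)) _) ⟩
  length (filter P? (map (inside ∷_) (subsets m t)) ++ filter P? (map (outside ∷_) (subsets m (suc t))))
    ≡⟨ length-++ (filter P? (map (inside ∷_) (subsets m t))) ⟩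
  length (filter P? (map (inside ∷_) (subsets m t))) + length (filter P? (map (outside ∷_) (subsets m (suc t))))
    ≡⟨ cong₂ _+_ (length-filter-map P? (inside ∷_) (subsets m t)) (length-filter-map P? (outside ∷_) (subsets m (suc t))) ⟩
  length (filter (P? ∘ (inside ∷_)) (subsets m t)) + length (filter (P? ∘ (outside ∷_)) (subsets m (suc t))) ∎
  where open ≡-Reasoning

length-filter-⊆-subsets : ∀ {m} t (S : Subset m) → length (filter (_⊆? S) (subsets m t)) ≡ ∣ S ∣ C t
length-filter-⊆-subsets         zero    S = cong length (filter-accept (_⊆? S) ⊥⊆)
length-filter-⊆-subsets {zero}  (suc t) [] = refl
length-filter-⊆-subsets {suc m} (suc t) (inside ∷ S) = begin
  length (filter (_⊆? inside ∷ S) (subsets (suc m) (suc t)))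
    ≡⟨ length-filter-subsets-suc m t (_⊆? inside ∷ S) ⟩
  length (filter (λ T → inside ∷ T ⊆? inside ∷ S) (subsets m t))
    + length (filter (λ T → outside ∷ T ⊆? inside ∷ S) (subsets m (suc t)))
    ≡⟨ cong₂ (λ xs ys → length xs + length ys)
             (filter-≐ _ (_⊆? S) (drop-∷-⊆ , in⊆in) (subsets m t))
             (filter-≐ _ (_⊆? S) (drop-∷-⊆ , out⊆) (subsets m (suc t))) ⟩
  length (filter (_⊆? S) (subsets m t)) + length (filter (_⊆? S) (subsets m (suc t)))
    ≡⟨ cong₂ _+_ (length-filter-⊆-subsets t S) (length-filter-⊆-subsets (suc t) S) ⟩
  ∣ S ∣ C t + ∣ S ∣ C suc t
    ≡⟨ nCk+nC[k+1]≡[n+1]C[k+1] ∣ S ∣ t ⟩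
  suc ∣ S ∣ C suc t ∎
  where open ≡-Reasoning
length-filter-⊆-subsets {suc m} (suc t) (outside ∷ S) = begin
  length (filter (_⊆? outside ∷ S) (subsets (suc m) (suc t)))
    ≡⟨ length-filter-subsets-suc m t (_⊆? outside ∷ S) ⟩
  length (filter (λ T → inside ∷ T ⊆? outside ∷ S) (subsets m t))
    + length (filter (λ T → outside ∷ T ⊆? outside ∷ S) (subsets m (suc t)))
    ≡⟨ cong₂ (λ xs ys → length xs + length ys)
             (filter-none _ {subsets m t} (All.tabulate (λ _ T⊆S → case T⊆S here of λ ())))
             (filter-≐ _ (_⊆? S) (drop-∷-⊆ , out⊆) (subsets m (suc t))) ⟩
  length (filter (_⊆? S) (subsets m (suc t)))
    ≡⟨ length-filter-⊆-subsets (suc t) S ⟩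
  ∣ S ∣ C suc t ∎
  where open ≡-Reasoning

length-subsets : ∀ m t → length (subsets m t) ≡ m C t
length-subsets m t = begin
  length (subsets m t)                         ≡⟨ cong length (filter-all (_⊆? full) {subsets m t} (All.tabulate (λ _ → ⊆⊤))) ⟨
  length (filter (_⊆? full) (subsets m t))     ≡⟨ length-filter-⊆-subsets t full ⟩
  ∣ full {m} ∣ C t                             ≡⟨ cong (_C t) (∣⊤∣≡n m) ⟩
  m C t                                        ∎
  where open ≡-Reasoning

∃-≥-average : ∀ (f : A → ℕ) xs → 0 < length xs → ∃[ x ] x ∈ₗ xs × sum (map f xs) ≤ length xs * f x
∃-≥-average f (x ∷ [])     _ = x , here refl , ≤-refl
∃-≥-average f (x ∷ y ∷ ys) _ with ∃-≥-average f (y ∷ ys) (s≤s z≤n)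
... | z , z∈ys , avg≤ with f x ≤? f z
...   | yes fx≤fz = z , there z∈ys , +-mono-≤ fx≤fz avg≤
...   | no  fx≰fz = x , here refl ,
                    +-monoʳ-≤ (f x) (≤-trans avg≤ (*-monoʳ-≤ (length (y ∷ ys)) (<⇒≤ (≰⇒> fx≰fz))))

ceilDiv-≤ : ∀ {a b c} → a ≤ c * b → ceilDiv a b ≤ c
ceilDiv-≤ {b = zero}            _     = z≤n
ceilDiv-≤ {a} {b = suc k} {c} a≤c*b = <⇒≤pred (m<n*o⇒m/o<n (begin-strict
  a + k             <⟨ +-mono-≤-< a≤c*b (n<1+n k) ⟩
  c * suc k + suc k ≡⟨ +-comm (c * suc k) (suc k) ⟩
  suc c * suc k     ∎))
  where open ≤-Reasoning

0<nCk : ∀ {n k} → k ≤ n → 0 < n C k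
0<nCk {n}     {zero}  _         = s≤s z≤n
0<nCk {suc n} {suc k} (s≤s k≤n) = ≤-trans (0<nCk k≤n)
  (≤-trans (m≤m+n (n C k) (n C suc k)) (≤-reflexive (nCk+nC[k+1]≡[n+1]C[k+1] n k)))

∣tabulate∣≡length-filter : ∀ {n} {P : Pred A ℓ} (P? : Decidable₁ P) (g : Fin n → A) →
                           ∣ tabulate (λ i → does (P? (g i))) ∣ ≡ length (filter P? (List.tabulate g))
∣tabulate∣≡length-filter {n = zero}  P? g = refl
∣tabulate∣≡length-filter {n = suc n} P? g with does (P? (g zero))
... | true  = cong suc (∣tabulate∣≡length-filter P? (g ∘ suc))
... | false = ∣tabulate∣≡length-filter P? (g ∘ suc)

∈-tabulate⁻ : ∀ {n} {P : Pred (Fin n) ℓ} (P? : Decidable₁ P) {i} → i ∈ tabulate (λ j → does (P? j)) → P i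
∈-tabulate⁻ P? {i} i∈ with P? i | trans (sym (lookup∘tabulate (λ j → does (P? j)) i)) ([]=⇒lookup i∈)
... | yes Pi | _  = Pi
... | no  _  | ()

_↪_ : ∀ {n} → ℕ → Subset n → Set
_↪_ {n} p S = Σ[ f ∈ (Fin p → Fin n) ] Injective _≡_ _≡_ f × (∀ a → f a ∈ S)

p≤∣S∣⇒p↪S : ∀ {n p} (S : Subset n) → p ≤ ∣ S ∣ → p ↪ S
p≤∣S∣⇒p↪S {p = zero}  S             _          = (λ ()) , (λ {a} _ → case a of λ ()) , λ ()
p≤∣S∣⇒p↪S {p = suc p} (outside ∷ S) p<∣S∣      with p≤∣S∣⇒p↪S S p<∣S∣
... | f , f-inj , f∈S = suc ∘ f , f-inj ∘ Fin.suc-injective , there ∘ f∈S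
p≤∣S∣⇒p↪S {p = suc p} (inside ∷ S)  (s≤s p≤∣S∣) with p≤∣S∣⇒p↪S S p≤∣S∣
... | f , f-inj , f∈S = g , g-inj , g∈S
  where
  g : Fin (suc p) → Fin _
  g = zero ∷ᶠ (suc ∘ f)
  g-inj : Injective _≡_ _≡_ g
  g-inj {zero}  {zero}  _  = refl
  g-inj {suc a} {suc b} eq = cong suc (f-inj (Fin.suc-injective eq))
  g-inj {zero}  {suc _} ()
  g-inj {suc _} {zero}  ()
  g∈S : ∀ a → g a ∈ inside ∷ S
  g∈S zero    = here
  g∈S (suc a) = there (f∈S a)

module _ {n m} (G : ColouredMultigraph n m) where

  colourSet : Fin n → Subset m
  colourSet v = tabulate (λ c → does (InV? G c v))

  verticesContaining : Subset m → Subset n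
  verticesContaining T = tabulate (λ v → does (T ⊆? colourSet v))

  colourDegree≡∣colourSet∣ : ∀ v → colourDegree G v ≡ ∣ colourSet v ∣
  colourDegree≡∣colourSet∣ v = sym (∣tabulate∣≡length-filter (λ c → InV? G c v) id)

  sum-∣verticesContaining∣ : ∀ t → sum (map (λ T → ∣ verticesContaining T ∣) (subsets m t))
                                 ≡ sum (map (λ v → colourDegree G v C t) (allFin n))
  sum-∣verticesContaining∣ t = begin
    sum (map (λ T → ∣ verticesContaining T ∣) (subsets m t))
      ≡⟨ cong sum (map-cong (λ T → ∣tabulate∣≡length-filter (λ v → T ⊆? colourSet v) id) (subsets m t)) ⟩
    sum (map (λ T → length (filter (λ v → T ⊆? colourSet v) (allFin n))) (subsets m t))
      ≡⟨ sum-length-filter-comm (λ T v → T ⊆? colourSet v) (subsets m t) (allFin n) ⟩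
    sum (map (λ v → length (filter (_⊆? colourSet v) (subsets m t))) (allFin n))
      ≡⟨ cong sum (map-cong (λ v → trans (length-filter-⊆-subsets t (colourSet v))
                                          (cong (_C t) (sym (colourDegree≡∣colourSet∣ v)))) (allFin n)) ⟩
    sum (map (λ v → colourDegree G v C t) (allFin n)) ∎
    where open ≡-Reasoning

  weightedSum≤ : ∀ t → weightedSum G t ≤ sum (map (λ v → colourDegree G v C t) (allFin n))
  weightedSum≤ t = sum-fibres≤ (colourDegree G) (_C t) (allFin n)
    (Unique.map⁺ (+-cancelˡ-≡ t _ _) (Unique.upTo⁺ (suc (m ∸ t))))

  superimposedCopy : ShufflePreserved G → ∀ {t p} T → t ≤ ∣ T ∣ → p ≤ ∣ verticesContaining T ∣ →
                     SuperimposedCopy G t p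
  superimposedCopy shuffle T t≤∣T∣ p≤∣V∣
    with p≤∣S∣⇒p↪S (verticesContaining T) p≤∣V∣ | p≤∣S∣⇒p↪S T t≤∣T∣
  ... | P , P-inj , P∈V | cs , cs-inj , cs∈T =
    P , cs , P-inj , cs-inj , λ j a b a≢b →
      shuffle (cs j) (P a) (P b) (a≢b ∘ P-inj) (incident (P∈V a) (cs∈T j)) (incident (P∈V b) (cs∈T j))
    where
    incident : ∀ {v c} → v ∈ verticesContaining T → c ∈ T → InV G c v
    incident {v} v∈V c∈T = ∈-tabulate⁻ (λ c → InV? G c v) (∈-tabulate⁻ (λ v → T ⊆? colourSet v) v∈V c∈T)

theorem5 : (n m : ℕ) (G : ColouredMultigraph n m) → Loopless G → ShufflePreserved G →
           (t : ℕ) → 1 ≤ t → t ≤ m → (p : ℕ) → 1 ≤ p →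
           p ≤ ceilDiv (weightedSum G t) (m C t) →
           SuperimposedCopy G t p
theorem5 n m G _ shuffle t _ t≤m p _ p≤⌈W/C⌉
  with ∃-≥-average (λ T → ∣ verticesContaining G T ∣) (subsets m t)
                   (subst (0 <_) (sym (length-subsets m t)) (0<nCk t≤m))
... | T , T∈subsets , average≤ =
  superimposedCopy G shuffle T (≤-reflexive (sym (All.lookup (subsets-size m t) T∈subsets)))
                   (≤-trans p≤⌈W/C⌉ (ceilDiv-≤ W≤V*C))
  where
  W≤V*C : weightedSum G t ≤ ∣ verticesContaining G T ∣ * (m C t)
  W≤V*C = begin
    weightedSum G t                                            ≤⟨ weightedSum≤ G t ⟩
    sum (map (λ v → colourDegree G v C t) (allFin n))          ≡⟨ sum-∣verticesContaining∣ G t ⟨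
    sum (map (λ T → ∣ verticesContaining G T ∣) (subsets m t)) ≤⟨ average≤ ⟩
    length (subsets m t) * ∣ verticesContaining G T ∣          ≡⟨ cong (_* _) (length-subsets m t) ⟩
    (m C t) * ∣ verticesContaining G T ∣                       ≡⟨ *-comm (m C t) _ ⟩
    ∣ verticesContaining G T ∣ * (m C t)                       ∎
    where open ≤-Reasoning
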